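{- Let $(S,\sqcup,\cap)$ be an ado-semilattice. If $a,b\in S$ have a common upper bound with respect to $\le$, and $d\in S$ satisfies $d\lesssim a$ and $d\lesssim b$, then $d\lesssim a\cap b$.
   Context: An ado-semilattice is an algebra $(S,\sqcup,\cap)$ such that $(S,\cap)$ is a semilattice and, writing $x\le y$ iff $x=x\cap y$, for all $x,y,z,d$: (i) $x\le x\sqcup y$; (ii) $(x\cap y)\sqcup(y\cap z)\le y$; (iii) $x\sqcup y\le x\sqcup(y\cap(x\sqcup y))$; (iv) $x\cap z\le(x\cap y)\sqcup z$; (v) $(x\cap d)\sqcup((y\cap d)\cap(z\cap d))=((x\cap d)\sqcup(y\cap d))\cap((x\cap d)\sqcup(z\cap d))$; (vi) $\sqcup$ is associative. The relation $x\lesssim y$ means $y\sqcup x=y$. -}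

module Defs where

open import Level using (Level; suc)
open import Data.Product using (∃-syntax; _×_)
open import Relation.Binary.PropositionalEquality using (_≡_)
open import Algebra.Core using (Op₂)
open import Algebra.Lattice.Structures using (IsSemilattice)

record AdoSemilattice (a : Level) : Set (suc a) where
  infixr 7 _∩_
  infixr 6 _⊔_
  infix  4 _≤_ _≲_
  field
    S   : Set a
    _⊔_ : Op₂ S
    _∩_ : Op₂ S
    ∩-isSemilattice : IsSemilattice _≡_ _∩_

  _≤_ : S → S → Set a
  x ≤ y = x ≡ x ∩ y

  field
    ax-i   : ∀ x y → x ≤ x ⊔ y
    ax-ii  : ∀ x y z → (x ∩ y) ⊔ (y ∩ z) ≤ y
    ax-iii : ∀ x y → x ⊔ y ≤ x ⊔ (y ∩ (x ⊔ y))
    ax-iv  : ∀ x y z → x ∩ z ≤ (x ∩ y) ⊔ z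
    ax-v   : ∀ x y z d →
             (x ∩ d) ⊔ ((y ∩ d) ∩ (z ∩ d))
               ≡ ((x ∩ d) ⊔ (y ∩ d)) ∩ ((x ∩ d) ⊔ (z ∩ d))
    ⊔-assoc : ∀ x y z → (x ⊔ y) ⊔ z ≡ x ⊔ (y ⊔ z)

  _≲_ : S → S → Set a
  x ≲ y = y ⊔ x ≡ y

-- Below a common upper bound c the order ≲ coincides with ≤, ⊔ is commutative, and
-- ⊔ distributes over ∩ (axiom v). So it suffices to show that (a ∩ b) ⊔ d ≤ c: then
-- (a ∩ b) ⊔ d ≤ a and ≤ b, hence ≤ a ∩ b ≤ (a ∩ b) ⊔ d. For this, the element
-- c₀ = c ∩ (d ⊔ c) lies below c and, by axiom iii, satisfies d ⊔ c₀ = d ⊔ c; so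
-- c₀ ⊔ x = c whenever x ≤ c and d ≲ x, and distributivity gives c₀ ⊔ (a ∩ b) =
-- (c₀ ⊔ a) ∩ (c₀ ⊔ b) = c. Hence (a ∩ b) ⊔ d ≤ (a ∩ b) ⊔ d ⊔ c₀ = c ⊔ d = c.
module Submission where

open import Defs
open import Data.Product using (∃-syntax; _×_; _,_)
open import Relation.Binary.PropositionalEquality
  using (_≡_; sym; trans; cong; cong₂; subst; subst₂; module ≡-Reasoning)
open import Relation.Binary.Bundles using (Poset)
open import Algebra.Structures using (IsCommutativeBand)
import Relation.Binary.Construct.NaturalOrder.Left as NaturalOrder

module AdoSemilatticeProperties {ℓ} (A : AdoSemilattice ℓ) where
  open AdoSemilattice A
  open IsCommutativeBand ∩-isSemilattice using (comm; idem)
  open NaturalOrder _≡_ _∩_ using (poset)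
  open Poset (poset ∩-isSemilattice) using ()
    renaming (refl to ≤-refl; trans to ≤-trans; antisym to ≤-antisym) public
  open ≡-Reasoning

  private
    variable
      x y z w : S

  x∩y≤x : ∀ x y → x ∩ y ≤ x
  x∩y≤x = NaturalOrder.x∙y≤x _≡_ _∩_ ∩-isSemilattice

  x∩y≤y : ∀ x y → x ∩ y ≤ y
  x∩y≤y = NaturalOrder.x∙y≤y _≡_ _∩_ ∩-isSemilattice

  ∩-glb : ∀ {x y} z → z ≤ x → z ≤ y → z ≤ x ∩ y
  ∩-glb = NaturalOrder.∙-presʳ-≤ _≡_ _∩_ ∩-isSemilattice

  x≤y⇒y∩x≡x : x ≤ y → y ∩ x ≡ x
  x≤y⇒y∩x≡x {x} {y} x≤y = trans (comm y x) (sym x≤y)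

  x≤y⇒x⊔y≡y : x ≤ y → x ⊔ y ≡ y
  x≤y⇒x⊔y≡y {x} {y} x≤y = ≤-antisym x⊔y≤y (subst₂ _≤_ (idem y) y⊔x≡x⊔y (ax-iv y x y))
    where
      x⊔y≤y : x ⊔ y ≤ y
      x⊔y≤y = subst (_≤ y) (cong₂ _⊔_ (sym x≤y) (idem y)) (ax-ii x y y)
      y⊔x≡x⊔y : (y ∩ x) ⊔ y ≡ x ⊔ y
      y⊔x≡x⊔y = cong (_⊔ y) (x≤y⇒y∩x≡x x≤y)

  ⊔-lub : x ≤ z → y ≤ z → x ⊔ y ≤ z
  ⊔-lub {x} {z} {y} x≤z y≤z =
    subst (_≤ z) (cong₂ _⊔_ (sym x≤z) (x≤y⇒y∩x≡x y≤z)) (ax-ii x z y)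

  ≤⇒≲ : x ≤ y → x ≲ y
  ≤⇒≲ {x} {y} x≤y = ≤-antisym (⊔-lub ≤-refl x≤y) (ax-i y x)

  ≲⇒≤ : x ≤ z → y ≤ z → x ≲ y → x ≤ y
  ≲⇒≤ {x} {z} {y} x≤z y≤z x≲y =
    subst₂ _≤_ (x≤y⇒y∩x≡x x≤z) (trans (cong (_⊔ x) (x≤y⇒y∩x≡x y≤z)) x≲y) (ax-iv z y x)

  ⊔-idem : x ⊔ x ≡ x
  ⊔-idem = x≤y⇒x⊔y≡y ≤-refl

  ≲⇒⊔-absorb : x ≲ y → y ⊔ (x ⊔ z) ≡ y ⊔ z
  ≲⇒⊔-absorb {x} {y} {z} x≲y = trans (sym (⊔-assoc y x z)) (cong (_⊔ z) x≲y)

  ≲-trans : x ≲ y → y ≲ z → x ≲ z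
  ≲-trans {x} {y} {z} x≲y y≲z = begin
    z ⊔ x       ≡⟨ ≲⇒⊔-absorb y≲z ⟨
    z ⊔ (y ⊔ x) ≡⟨ cong (z ⊔_) x≲y ⟩
    z ⊔ y       ≡⟨ y≲z ⟩
    z           ∎

  ≲-⊔ : x ≲ z → y ≲ z → x ⊔ y ≲ z
  ≲-⊔ x≲z y≲z = trans (≲⇒⊔-absorb x≲z) y≲z

  x≲y⊔x : x ≲ y ⊔ x
  x≲y⊔x {x} {y} = trans (⊔-assoc y x x) (cong (y ⊔_) ⊔-idem)

  ⊔-comm-bounded : x ≤ z → y ≤ z → x ⊔ y ≡ y ⊔ x
  ⊔-comm-bounded x≤z y≤z = ≤-antisym (≤-flip x≤z y≤z) (≤-flip y≤z x≤z)
    where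
      ≤-flip : ∀ {x y} → x ≤ z → y ≤ z → x ⊔ y ≤ y ⊔ x
      ≤-flip x≤z y≤z =
        ≲⇒≤ (⊔-lub x≤z y≤z) (⊔-lub y≤z x≤z) (≲-⊔ x≲y⊔x (≤⇒≲ (ax-i _ _)))

  ⊔≡⊔-∩⊔ : ∀ x y → x ⊔ y ≡ x ⊔ (y ∩ (x ⊔ y))
  ⊔≡⊔-∩⊔ x y = ≤-antisym (ax-iii x y) (⊔-lub (ax-i x y) (x∩y≤y y (x ⊔ y)))

  ⊔-distribˡ-∩-bounded : x ≤ z → y ≤ z → w ≤ z → x ⊔ (y ∩ w) ≡ (x ⊔ y) ∩ (x ⊔ w)
  ⊔-distribˡ-∩-bounded {x} {z} {y} {w} x≤z y≤z w≤z = begin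
    x ⊔ (y ∩ w)                           ≡⟨ cong₂ (λ s t → s ⊔ (t ∩ w)) x≤z y≤z ⟩
    (x ∩ z) ⊔ ((y ∩ z) ∩ w)               ≡⟨ cong (λ t → (x ∩ z) ⊔ ((y ∩ z) ∩ t)) w≤z ⟩
    (x ∩ z) ⊔ ((y ∩ z) ∩ (w ∩ z))         ≡⟨ ax-v x y w z ⟩
    ((x ∩ z) ⊔ (y ∩ z)) ∩ ((x ∩ z) ⊔ (w ∩ z))
      ≡⟨ cong₂ (λ s t → (s ⊔ t) ∩ (s ⊔ (w ∩ z))) (sym x≤z) (sym y≤z) ⟩
    (x ⊔ y) ∩ (x ⊔ (w ∩ z))               ≡⟨ cong (λ t → (x ⊔ y) ∩ (x ⊔ t)) (sym w≤z) ⟩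
    (x ⊔ y) ∩ (x ⊔ w)                     ∎

  x∩y⊔d≤z : ∀ {x y z d} → x ≤ z → y ≤ z → d ≲ x → d ≲ y → (x ∩ y) ⊔ d ≤ z
  x∩y⊔d≤z {x} {y} {z} {d} x≤z y≤z d≲x d≲y = subst ((x ∩ y) ⊔ d ≤_) e⊔d⊔z₀≡z (ax-i _ z₀)
    where
      e = x ∩ y
      z₀ = z ∩ (d ⊔ z)
      z₀≤z : z₀ ≤ z
      z₀≤z = x∩y≤x z (d ⊔ z)
      e≤z : e ≤ z
      e≤z = ≤-trans (x∩y≤x x y) x≤z
      z₀⊔w≡z : ∀ {w} → w ≤ z → d ≲ w → z₀ ⊔ w ≡ z
      z₀⊔w≡z {w} w≤z d≲w = begin
        z₀ ⊔ w       ≡⟨ ⊔-comm-bounded z₀≤z w≤z ⟩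
        w ⊔ z₀       ≡⟨ ≲⇒⊔-absorb d≲w ⟨
        w ⊔ (d ⊔ z₀) ≡⟨ cong (w ⊔_) (⊔≡⊔-∩⊔ d z) ⟨
        w ⊔ (d ⊔ z)  ≡⟨ ≲⇒⊔-absorb d≲w ⟩
        w ⊔ z        ≡⟨ x≤y⇒x⊔y≡y w≤z ⟩
        z            ∎
      z₀⊔e≡z : z₀ ⊔ e ≡ z
      z₀⊔e≡z = begin
        z₀ ⊔ (x ∩ y)        ≡⟨ ⊔-distribˡ-∩-bounded z₀≤z x≤z y≤z ⟩
        (z₀ ⊔ x) ∩ (z₀ ⊔ y) ≡⟨ cong₂ _∩_ (z₀⊔w≡z x≤z d≲x) (z₀⊔w≡z y≤z d≲y) ⟩
        z ∩ z               ≡⟨ idem z ⟩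
        z                   ∎
      e⊔d⊔z₀≡z : (e ⊔ d) ⊔ z₀ ≡ z
      e⊔d⊔z₀≡z = begin
        (e ⊔ d) ⊔ z₀ ≡⟨ ⊔-assoc e d z₀ ⟩
        e ⊔ (d ⊔ z₀) ≡⟨ cong (e ⊔_) (⊔-comm-bounded (ax-i d z) (x∩y≤y z (d ⊔ z))) ⟩
        e ⊔ (z₀ ⊔ d) ≡⟨ ⊔-assoc e z₀ d ⟨
        (e ⊔ z₀) ⊔ d ≡⟨ cong (_⊔ d) (trans (⊔-comm-bounded e≤z z₀≤z) z₀⊔e≡z) ⟩
        z ⊔ d        ≡⟨ ≲-trans d≲x (≤⇒≲ x≤z) ⟩
        z            ∎

lemma3p5 : ∀ {ℓ} (A : AdoSemilattice ℓ) → let open AdoSemilattice A in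
    ∀ (a b d : S) → (∃[ c ] (a ≤ c × b ≤ c)) → d ≲ a → d ≲ b → d ≲ a ∩ b
lemma3p5 A a b d (c , a≤c , b≤c) d≲a d≲b = ≤-antisym e⊔d≤e (ax-i (a ∩ b) d)
  where
    open AdoSemilattice A
    open AdoSemilatticeProperties A
    e⊔d≤c : (a ∩ b) ⊔ d ≤ c
    e⊔d≤c = x∩y⊔d≤z a≤c b≤c d≲a d≲b
    e⊔d≤x : ∀ {x} → x ≤ c → a ∩ b ≤ x → d ≲ x → (a ∩ b) ⊔ d ≤ x
    e⊔d≤x x≤c e≤x d≲x = ≲⇒≤ e⊔d≤c x≤c (≲-⊔ (≤⇒≲ e≤x) d≲x)
    e⊔d≤e : (a ∩ b) ⊔ d ≤ a ∩ b
    e⊔d≤e = ∩-glb _ (e⊔d≤x a≤c (x∩y≤x a b) d≲a) (e⊔d≤x b≤c (x∩y≤y a b) d≲b)
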